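{- Let $G$ be an abelian group and $\mathcal A=(A_1,\dots,A_q)$ where for each $i$, $A_i=F_i+M_i$ with $F_i\subseteq G$ finite and nonempty, $M_i\subseteq G$ a submonoid (i.e. $0\in M_i$, $M_i+M_i\subseteq M_i$), and $k_i:=|F_i|$. Then for every $r\in\mathbb N$ and every $\mathbf h\in\mathbb N_0^q$ there exists $X_{\mathbf h}\subseteq G$ with $(r\mathbf h)\cdot\mathcal A\subseteq X_{\mathbf h}+\mathbf h\cdot\mathcal A$ and \[ |X_{\mathbf h}|\le\prod_{i=1}^q\binom{(r+1)(k_i-1)}{k_i-1}. \] In particular $\mathcal A$ is a chromatic $(r,\ell)$-approximate group with $\ell=\prod_{i=1}^q\binom{(r+1)(k_i-1)}{k_i-1}$.
   Context: $\mathbb N=\{1,2,\dots\}$, $\mathbb N_0=\{0,1,2,\dots\}$. For subsets $X,Y$ of an abelian group, $X+Y=\{x+y:x\in X,y\in Y\}$; for $h\in\mathbb N$, $hA$ is the $h$-fold sumset $A+\cdots+A$ and $0A=\{0\}$. For $\mathbf h=(h_1,\dots,h_q)\in\mathbb N_0^q$, $\mathbf h\cdot\mathcal A=h_1A_1+\cdots+h_qA_q$ and $r\mathbf h=(rh_1,\dots,rh_q)$. A tuple $\mathcal A$ is a chromatic $(r,\ell)$-approximate group if for every $\mathbf h\in\mathbb N_0^q$ there is $X_{\mathbf h}\subseteq G$ with $|X_{\mathbf h}|\le\ell$ and $(r\mathbf h)\cdot\mathcal A\subseteq X_{\mathbf h}+\mathbf h\cdot\mathcal A$. -}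

module Defs where

open import Level using (Level; _⊔_; Lift)
open import Algebra.Bundles using (AbelianGroup)
open import Data.Nat using (ℕ; zero; suc; _*_)
open import Data.Fin using (Fin; zero; suc)
open import Data.List using (List)
open import Data.List.Relation.Unary.Any using (Any)
open import Data.Product using (Σ; _×_; ∃-syntax)
open import Relation.Unary using (Pred)

∏ : ∀ {q} → (Fin q → ℕ) → ℕ
∏ {zero}  f = 1
∏ {suc q} f = f zero * ∏ (λ i → f (suc i))

module _ {c ℓ : Level} (G : AbelianGroup c ℓ) where
  open AbelianGroup G renaming (Carrier to A)

  -- subsets of G (as predicates; equality in G is the setoid equality ≈)
  Subset : Set _
  Subset = Pred A (c ⊔ ℓ)

  _⊕_ : Subset → Subset → Subset
  (X ⊕ Y) z = ∃[ x ] ∃[ y ] (X x × Y y × Lift c (z ≈ x ∙ y))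

  zeroSet : Subset
  zeroSet z = Lift c (z ≈ ε)

  listSet : List A → Subset
  listSet xs z = Lift c (Any (z ≈_) xs)

  _·ₛ_ : ℕ → Subset → Subset
  zero  ·ₛ X = zeroSet
  suc h ·ₛ X = X ⊕ (h ·ₛ X)

  _·ᶜ_ : ∀ {q} → (Fin q → ℕ) → (Fin q → Subset) → Subset
  _·ᶜ_ {zero}  h 𝒜 = zeroSet
  _·ᶜ_ {suc q} h 𝒜 = (h zero ·ₛ 𝒜 zero) ⊕ ((λ i → h (suc i)) ·ᶜ (λ i → 𝒜 (suc i)))

  record IsSubmonoid (M : Subset) : Set (c ⊔ ℓ) where
    field
      resp : ∀ {x y} → x ≈ y → M x → M y
      has-ε : M ε
      closed : ∀ {x y} → M x → M y → M (x ∙ y)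

{-# OPTIONS --safe #-}
module Submission where

-- Write F = x ∷ xs with m = |xs|.  Every element of (h + D)·F is i·x + w with w ∈ j·xs and
-- i + j = h + D.  If m·D ≤ a·h, then (h + D)·F is covered by C(m + a, m) translates of h·F, by
-- induction on m and a: take the largest p ≤ h with (m − 1)·D ≤ a·(h ∸ p).  Elements with i ≤ p
-- are handled by the cover of ((h ∸ p) + D)·xs (the claim for xs and a); the others are s·x plus
-- an element of (h + (D ∸ s))·F with s = min(p + 1, D), a set satisfying the claim for F and
-- a − 1.  Pascal's rule C(m − 1 + a, m − 1) + C(m + a − 1, m) = C(m + a, m) adds up the counts.
-- For A = F + M with M a submonoid, (r·h)·M ⊆ h·M, and a = r·m, D = (r − 1)·h give the bound
-- C((r + 1)·m, m); the covers of the q coordinates multiply.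

open import Defs
open import Level using (Level; _⊔_; lift)
open import Algebra.Bundles using (AbelianGroup)
open import Data.Nat as ℕ using (ℕ; zero; suc; _+_; _*_; _∸_; _⊓_; _≤_; _<_; _≥_; _≤?_; z≤n; s≤s; s≤s⁻¹)
open import Data.Nat.Properties
open import Data.Nat.Combinatorics using (_C_; nCn≡1; nCk+nC[k+1]≡[n+1]C[k+1])
open import Data.Nat.Tactic.RingSolver using (solve-∀)
open import Data.Fin using (Fin; zero; suc)
open import Data.List using (List; []; _∷_; [_]; length; map; _++_; cartesianProductWith)
open import Data.List.Properties using (length-++; length-map)
open import Data.List.Relation.Unary.Any using (here; there)
open import Data.List.Relation.Unary.Any.Properties using (++⁺ˡ; ++⁺ʳ; cartesianProductWith⁺)
open import Data.List.Relation.Unary.Unique.Setoid using (Unique)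
open import Data.Product using (_×_; ∃-syntax; ∃₂; _,_)
open import Data.Sum using (inj₁; inj₂)
open import Data.Empty using (⊥)
open import Function using (_∘_)
open import Relation.Binary.Definitions using (_Respects_)
open import Relation.Binary.PropositionalEquality using (_≡_; refl; sym; trans; cong; cong₂; subst; module ≡-Reasoning)
open import Relation.Nullary using (¬_; yes; no)
open import Relation.Unary using (Pred; Decidable; _⊆_)

last-satisfying : ∀ {p} {P : Pred ℕ p} → Decidable P → ∀ h → P 0 →
                  ∃[ n ] (n ≤ h × P n × (n < h → ¬ P (suc n)))
last-satisfying P? zero    P0 = 0 , z≤n , P0 , λ ()
last-satisfying P? (suc h) P0 with P? 1
... | no ¬P1 = 0 , z≤n , P0 , λ _ → ¬P1
... | yes P1 with last-satisfying (P? ∘ suc) h P1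
...   | n , n≤h , Pn , maximal = suc n , s≤s n≤h , Pn , maximal ∘ s≤s⁻¹

no-excess : ∀ k {L R} → L ≡ suc k + R → L ≤ R → ⊥
no-excess k {R = R} refl = m+n≮n k R

pred-condition-at-top : ∀ m a {h D} W → suc h + W ≡ D →
                        suc m * D ≤ suc a * h → suc m * W ≤ a * h
pred-condition-at-top m a {h} W refl H =
  ≮⇒≥ λ T → no-excess (m * suc h + 1) (excess m a h W) (+-mono-≤ H T)
  where
  excess : ∀ m a h W →
    suc m * (suc h + W) + suc (a * h) ≡ suc (m * suc h + 1) + (suc a * h + suc m * W)
  excess = solve-∀

-- Weighting H, N and the negated goal by a + 1 + m, m + 1 and a + 1 and adding them gives an
-- inequality whose left side exceeds its right side by m + a + 2.
pred-condition-below-top : ∀ m a {h D} P u W → P + W ≡ D → P + u ≡ h →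
                           suc m * D ≤ suc a * h → suc a * u < m * D → suc m * W ≤ a * h
pred-condition-below-top m a P u W refl refl H N =
  ≮⇒≥ λ T → no-excess (m + a + 1) (excess m a P u W)
    (+-mono-≤ (+-mono-≤ (*-monoʳ-≤ (suc a + m) H) (*-monoʳ-≤ (suc m) N)) (*-monoʳ-≤ (suc a) T))
  where
  excess : ∀ m a P u W →
    (suc a + m) * (suc m * (P + W)) + suc m * suc (suc a * u) + suc a * suc (a * (P + u))
    ≡ suc (m + a + 1)
      + ((suc a + m) * (suc a * (P + u)) + suc m * (m * (P + W)) + suc a * (suc m * W))
  excess = solve-∀

split-threshold : ∀ m a D h → suc m * D ≤ suc a * h →
                  ∃[ p ] (p ≤ h × m * D ≤ suc a * (h ∸ p) × suc m * (D ∸ suc p) ≤ a * h)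
split-threshold m a D h H
  with last-satisfying (λ p → m * D ≤? suc a * (h ∸ p)) h (≤-trans (*-monoˡ-≤ D (n≤1+n m)) H)
... | p , p≤h , mD≤ , maximal = p , p≤h , mD≤ , above-threshold
  where
  above-threshold : suc m * (D ∸ suc p) ≤ a * h
  above-threshold with suc p ≤? D | m≤n⇒m<n∨m≡n p≤h
  ... | no p+1≰D | _ =
    subst (_≤ a * h) (sym (trans (cong (suc m *_) (m≤n⇒m∸n≡0 (≰⇒≥ p+1≰D))) (*-zeroʳ (suc m)))) z≤n
  ... | yes p<D | inj₂ refl = pred-condition-at-top m a (D ∸ suc p) (m+[n∸m]≡n p<D) H
  ... | yes p<D | inj₁ p<h =
    pred-condition-below-top m a (suc p) (h ∸ suc p) (D ∸ suc p)
      (m+[n∸m]≡n p<D) (m+[n∸m]≡n p<h) H (≰⇒> (maximal p<h))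

∸-telescope : ∀ {i p h} → i ≤ p → p ≤ h → i + ((p ∸ i) + (h ∸ p)) ≡ h
∸-telescope {i} {p} {h} i≤p p≤h = trans (sym (+-assoc i (p ∸ i) (h ∸ p)))
  (trans (cong (_+ (h ∸ p)) (m+[n∸m]≡n i≤p)) (m+[n∸m]≡n p≤h))

below-threshold-index : ∀ {i j p h D} → i ≤ p → p ≤ h → i + j ≡ h + D →
                        j ≡ (p ∸ i) + ((h ∸ p) + D)
below-threshold-index {i} {j} {p} {h} {D} i≤p p≤h i+j≡ = +-cancelˡ-≡ i j _ (begin
  i + j                                ≡⟨ i+j≡ ⟩
  h + D                                ≡⟨ cong (_+ D) (∸-telescope i≤p p≤h) ⟨
  (i + ((p ∸ i) + (h ∸ p))) + D        ≡⟨ +-assoc i _ D ⟩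
  i + (((p ∸ i) + (h ∸ p)) + D)        ≡⟨ cong (i +_) (+-assoc (p ∸ i) (h ∸ p) D) ⟩
  i + ((p ∸ i) + ((h ∸ p) + D))        ∎)
  where open ≡-Reasoning

above-threshold-index : ∀ {i j s h D} → s ≤ i → s ≤ D → i + j ≡ h + D →
                        (i ∸ s) + j ≡ h + (D ∸ s)
above-threshold-index {j = j} {s} {h} s≤i s≤D i+j≡ =
  trans (sym (+-∸-comm j s≤i)) (trans (cong (_∸ s) i+j≡) (+-∸-assoc h s≤D))

m∸[n⊓m]≡m∸n : ∀ m n → m ∸ (n ⊓ m) ≡ m ∸ n
m∸[n⊓m]≡m∸n m n =
  trans (∸-distribˡ-⊓-⊔ m n m) (trans (cong ((m ∸ n) ℕ.⊔_) (n∸n≡0 m)) (⊔-identityʳ (m ∸ n)))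

pascal-≤ : ∀ {x y} m a → x ≤ (m + suc a) C m → y ≤ (suc m + a) C suc m →
           x + y ≤ (suc m + suc a) C suc m
pascal-≤ {x} {y} m a x≤ y≤ =
  subst (x + y ≤_) (nCk+nC[k+1]≡[n+1]C[k+1] (m + suc a) m)
    (+-mono-≤ x≤ (subst (λ n → y ≤ n C suc m) (sym (+-suc m a)) y≤))

m*[r*h]≤[1+r]*m*h : ∀ m r h → m * (r * h) ≤ (suc r * m) * h
m*[r*h]≤[1+r]*m*h m r h =
  subst (_≤ (suc r * m) * h) (sym (reorder m r h)) (*-monoˡ-≤ h (*-monoˡ-≤ m (n≤1+n r)))
  where
  reorder : ∀ m r h → m * (r * h) ≡ (r * m) * h
  reorder = solve-∀

module _ {c ℓ : Level} (G : AbelianGroup c ℓ) where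
  open AbelianGroup G
    renaming (Carrier to A; refl to ≈-refl; sym to ≈-sym; trans to ≈-trans)
  open import Algebra.Properties.Monoid.Mult monoid
    using (×-homo-+; ×-congˡ) renaming (_×_ to _×ᵍ_)

  infixr 7 _·_
  infixr 6 _+ₛ_

  _+ₛ_ : Subset G → Subset G → Subset G
  _+ₛ_ = _⊕_ G

  _·_ : ℕ → Subset G → Subset G
  _·_ = _·ₛ_ G

  ⟦_⟧ : List A → Subset G
  ⟦_⟧ = listSet G

  private variable
    P P′ Q Q′ R S : Subset G

  +ₛ-mono : P ⊆ P′ → Q ⊆ Q′ → P +ₛ Q ⊆ P′ +ₛ Q′
  +ₛ-mono P⊆ Q⊆ (x , y , x∈ , y∈ , z≈) = x , y , P⊆ x∈ , Q⊆ y∈ , z≈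

  +ₛ-monoˡ : P ⊆ P′ → P +ₛ Q ⊆ P′ +ₛ Q
  +ₛ-monoˡ P⊆P′ (x , y , x∈ , y∈ , z≈) = x , y , P⊆P′ x∈ , y∈ , z≈

  +ₛ-monoʳ : Q ⊆ Q′ → P +ₛ Q ⊆ P +ₛ Q′
  +ₛ-monoʳ Q⊆Q′ (x , y , x∈ , y∈ , z≈) = x , y , x∈ , Q⊆Q′ y∈ , z≈

  +ₛ-resp-≈ : (P +ₛ Q) Respects _≈_
  +ₛ-resp-≈ z≈z′ (x , y , x∈ , y∈ , lift z≈xy) = x , y , x∈ , y∈ , lift (≈-trans (≈-sym z≈z′) z≈xy)

  +ₛ-comm : P +ₛ Q ⊆ Q +ₛ P
  +ₛ-comm (x , y , x∈ , y∈ , lift z≈xy) = y , x , y∈ , x∈ , lift (≈-trans z≈xy (comm x y))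

  +ₛ-assoc : (P +ₛ Q) +ₛ R ⊆ P +ₛ (Q +ₛ R)
  +ₛ-assoc (w , z , (x , y , x∈ , y∈ , lift w≈xy) , z∈ , lift v≈wz) =
    x , y ∙ z , x∈ , (y , z , y∈ , z∈ , lift ≈-refl) ,
    lift (≈-trans v≈wz (≈-trans (∙-cong w≈xy ≈-refl) (assoc x y z)))

  +ₛ-assoc⁻ : P +ₛ (Q +ₛ R) ⊆ (P +ₛ Q) +ₛ R
  +ₛ-assoc⁻ (x , w , x∈ , (y , z , y∈ , z∈ , lift w≈yz) , lift v≈xw) =
    x ∙ y , z , (x , y , x∈ , y∈ , lift ≈-refl) , z∈ ,
    lift (≈-trans v≈xw (≈-trans (∙-cong ≈-refl w≈yz) (≈-sym (assoc x y z))))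

  +ₛ-left-comm : P +ₛ (Q +ₛ R) ⊆ Q +ₛ (P +ₛ R)
  +ₛ-left-comm z∈ = +ₛ-assoc (+ₛ-monoˡ +ₛ-comm (+ₛ-assoc⁻ z∈))

  +ₛ-interchange : (P +ₛ Q) +ₛ (R +ₛ S) ⊆ (P +ₛ R) +ₛ (Q +ₛ S)
  +ₛ-interchange z∈ = +ₛ-assoc⁻ (+ₛ-monoʳ +ₛ-left-comm (+ₛ-assoc z∈))

  +ₛ-identityˡ : Q Respects _≈_ → zeroSet G +ₛ Q ⊆ Q
  +ₛ-identityˡ resp (x , y , lift x≈ε , y∈ , lift z≈xy) =
    resp (≈-sym (≈-trans z≈xy (≈-trans (∙-cong x≈ε ≈-refl) (identityˡ y)))) y∈

  +ₛ-identityˡ⁻ : Q ⊆ zeroSet G +ₛ Q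
  +ₛ-identityˡ⁻ {x = z} z∈ = ε , z , lift ≈-refl , z∈ , lift (≈-sym (identityˡ z))

  zeroSet⊆⟦ε⟧ : zeroSet G ⊆ ⟦ [ ε ] ⟧
  zeroSet⊆⟦ε⟧ (lift z≈ε) = lift (here z≈ε)

  ·-mono : ∀ n → P ⊆ Q → n · P ⊆ n · Q
  ·-mono zero    _ z∈ = z∈
  ·-mono (suc n) P⊆Q = +ₛ-mono P⊆Q (·-mono n P⊆Q)

  ·-resp-≈ : ∀ n → (n · P) Respects _≈_
  ·-resp-≈ zero    z≈z′ (lift z≈ε) = lift (≈-trans (≈-sym z≈z′) z≈ε)
  ·-resp-≈ (suc n) = +ₛ-resp-≈

  ·-+-split : ∀ m n → (m + n) · P ⊆ m · P +ₛ n · P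
  ·-+-split zero    n = +ₛ-identityˡ⁻
  ·-+-split (suc m) n z∈ = +ₛ-assoc⁻ (+ₛ-monoʳ (·-+-split m n) z∈)

  ·-+-merge : ∀ m n → m · P +ₛ n · P ⊆ (m + n) · P
  ·-+-merge zero    n = +ₛ-identityˡ (·-resp-≈ n)
  ·-+-merge (suc m) n z∈ = +ₛ-monoʳ (·-+-merge m n) (+ₛ-assoc z∈)

  ·-distrib-+ₛ : ∀ n → n · (P +ₛ Q) ⊆ n · P +ₛ n · Q
  ·-distrib-+ₛ zero    = +ₛ-identityˡ⁻
  ·-distrib-+ₛ (suc n) z∈ = +ₛ-interchange (+ₛ-monoʳ (·-distrib-+ₛ n) z∈)

  ·-merge-+ₛ : ∀ n → n · P +ₛ n · Q ⊆ n · (P +ₛ Q)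
  ·-merge-+ₛ {P} {Q} zero = +ₛ-identityˡ (·-resp-≈ {P = P +ₛ Q} zero)
  ·-merge-+ₛ (suc n) z∈ = +ₛ-monoʳ (·-merge-+ₛ n) (+ₛ-interchange z∈)

  sums : List A → List A → List A
  sums = cartesianProductWith _∙_

  length-sums : ∀ xs ys → length (sums xs ys) ≡ length xs * length ys
  length-sums []       ys = refl
  length-sums (x ∷ xs) ys =
    trans (length-++ (map (x ∙_) ys)) (cong₂ _+_ (length-map (x ∙_) ys) (length-sums xs ys))

  ⟦⟧-+ₛ-sums : ∀ {xs ys} → ⟦ xs ⟧ +ₛ ⟦ ys ⟧ ⊆ ⟦ sums xs ys ⟧
  ⟦⟧-+ₛ-sums (x , y , lift x∈ , lift y∈ , lift z≈xy) =
    lift (cartesianProductWith⁺ _∙_ (λ x≈ y≈ → ≈-trans z≈xy (∙-cong x≈ y≈)) x∈ y∈)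

  ⟦⟧-++⁺ˡ : ∀ {xs ys} → ⟦ xs ⟧ ⊆ ⟦ xs ++ ys ⟧
  ⟦⟧-++⁺ˡ (lift z∈) = lift (++⁺ˡ z∈)

  ⟦⟧-++⁺ʳ : ∀ xs {ys} → ⟦ ys ⟧ ⊆ ⟦ xs ++ ys ⟧
  ⟦⟧-++⁺ʳ xs (lift z∈) = lift (++⁺ʳ xs z∈)

  ⟦⟧-∷⁺ : ∀ {x xs} → ⟦ xs ⟧ ⊆ ⟦ x ∷ xs ⟧
  ⟦⟧-∷⁺ (lift z∈) = lift (there z∈)

  ⟦[]⟧-⊆ : ∀ {x} → P Respects _≈_ → P x → ⟦ [ x ] ⟧ ⊆ P
  ⟦[]⟧-⊆ resp x∈ (lift (here z≈x)) = resp (≈-sym z≈x) x∈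

  ×ᵍ-∈-· : ∀ n {x} → P x → (n · P) (n ×ᵍ x)
  ×ᵍ-∈-· zero    x∈ = lift ≈-refl
  ×ᵍ-∈-· (suc n) x∈ = _ , _ , x∈ , ×ᵍ-∈-· n x∈ , lift ≈-refl

  ·-⟦[]⟧ : ∀ n {x} → n · ⟦ [ x ] ⟧ ⊆ ⟦ [ n ×ᵍ x ] ⟧
  ·-⟦[]⟧ zero    (lift z≈ε) = lift (here z≈ε)
  ·-⟦[]⟧ (suc n) (y , w , lift (here y≈x) , w∈ , lift z≈yw) with ·-⟦[]⟧ n w∈
  ... | lift (here w≈nx) = lift (here (≈-trans z≈yw (∙-cong y≈x w≈nx)))

  ×ᵍ-split : ∀ {s i x} → s ≤ i → ⟦ [ i ×ᵍ x ] ⟧ ⊆ ⟦ [ s ×ᵍ x ] ⟧ +ₛ ⟦ [ (i ∸ s) ×ᵍ x ] ⟧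
  ×ᵍ-split {s} {i} {x} s≤i (lift (here z≈)) =
    _ , _ , lift (here ≈-refl) , lift (here ≈-refl) ,
    lift (≈-trans z≈ (≈-trans (×-congˡ (sym (m+[n∸m]≡n s≤i))) (×-homo-+ x s (i ∸ s))))

  ·-∷-merge : ∀ i {j x xs} → ⟦ [ i ×ᵍ x ] ⟧ +ₛ j · ⟦ xs ⟧ ⊆ (i + j) · ⟦ x ∷ xs ⟧
  ·-∷-merge i {j} z∈ = ·-+-merge i j
    (+ₛ-mono (⟦[]⟧-⊆ (·-resp-≈ i) (×ᵍ-∈-· i (lift (here ≈-refl)))) (·-mono j ⟦⟧-∷⁺) z∈)

  ·-∷-decompose : ∀ n {x xs z} → (n · ⟦ x ∷ xs ⟧) z →
                  ∃₂ λ i j → i + j ≡ n × (⟦ [ i ×ᵍ x ] ⟧ +ₛ j · ⟦ xs ⟧) z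
  ·-∷-decompose zero z∈ = 0 , 0 , refl , +ₛ-monoˡ zeroSet⊆⟦ε⟧ (+ₛ-identityˡ⁻ z∈)
  ·-∷-decompose (suc n) {x} (y , w , lift y∈ , w∈ , z≈yw) with ·-∷-decompose n w∈
  ... | i , j , i+j≡n , w∈′ with y∈
  ...   | here y≈x  = suc i , j , cong suc i+j≡n , +ₛ-monoˡ (⟦⟧-+ₛ-sums {[ x ]} {[ i ×ᵍ x ]})
                        (+ₛ-assoc⁻ (y , w , lift (here y≈x) , w∈′ , z≈yw))
  ...   | there y∈′ = i , suc j , trans (+-suc i j) (cong suc i+j≡n) ,
                      +ₛ-left-comm (y , w , lift y∈′ , w∈′ , z≈yw)

  Covered : Subset G → ℕ → Subset G → Set (c ⊔ ℓ)
  Covered P n Q = ∃[ xs ] (length xs ≤ n × P ⊆ ⟦ xs ⟧ +ₛ Q)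

  ⊆⇒covered : P ⊆ Q → Covered P 1 Q
  ⊆⇒covered P⊆Q = [ ε ] , ≤-refl , λ z∈ → +ₛ-monoˡ zeroSet⊆⟦ε⟧ (+ₛ-identityˡ⁻ (P⊆Q z∈))

  covered-≤ : ∀ {m n} → m ≤ n → Covered P m Q → Covered P n Q
  covered-≤ m≤n (xs , len , cov) = xs , ≤-trans len m≤n , cov

  covered-mono : ∀ {n} → P′ ⊆ P → Q ⊆ Q′ → Covered P n Q → Covered P′ n Q′
  covered-mono P′⊆P Q⊆Q′ (xs , len , cov) = xs , len , λ z∈ → +ₛ-monoʳ Q⊆Q′ (cov (P′⊆P z∈))

  covered-+ₛ : ∀ {m n} → Covered P m Q → Covered P′ n Q′ → Covered (P +ₛ P′) (m * n) (Q +ₛ Q′)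
  covered-+ₛ (xs , len , cov) (xs′ , len′ , cov′) =
    sums xs xs′ ,
    subst (_≤ _) (sym (length-sums xs xs′)) (*-mono-≤ len len′) ,
    λ z∈ → +ₛ-monoˡ ⟦⟧-+ₛ-sums (+ₛ-interchange (+ₛ-mono cov cov′ z∈))

  covered-+ₛ-⊆ : ∀ {n} → Covered P n Q → P′ ⊆ Q′ → Covered (P +ₛ P′) n (Q +ₛ Q′)
  covered-+ₛ-⊆ (xs , len , cov) P′⊆Q′ = xs , len , λ z∈ → +ₛ-assoc (+ₛ-mono cov P′⊆Q′ z∈)

  covered-·ᶜ : ∀ {q} (h′ h : Fin q → ℕ) (𝒜 : Fin q → Subset G) (n : Fin q → ℕ) →
               (∀ i → Covered (h′ i · 𝒜 i) (n i) (h i · 𝒜 i)) →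
               Covered (_·ᶜ_ G h′ 𝒜) (∏ n) (_·ᶜ_ G h 𝒜)
  covered-·ᶜ {zero}  h′ h 𝒜 n cov = ⊆⇒covered (λ z∈ → z∈)
  covered-·ᶜ {suc q} h′ h 𝒜 n cov =
    covered-+ₛ (cov zero) (covered-·ᶜ (h′ ∘ suc) (h ∘ suc) (𝒜 ∘ suc) (n ∘ suc) (cov ∘ suc))

  cover-extend : ∀ t {N u xs} → N · P ⊆ ⟦ xs ⟧ +ₛ u · P → (t + N) · P ⊆ ⟦ xs ⟧ +ₛ (t + u) · P
  cover-extend t {N} {u} cov z∈ = +ₛ-monoʳ (·-+-merge t u) (+ₛ-left-comm (+ₛ-monoʳ cov (·-+-split t N z∈)))

  cover-below : ∀ {x xs ys N u t j h} i → i + (t + u) ≡ h → j ≡ t + N →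
                N · ⟦ xs ⟧ ⊆ ⟦ ys ⟧ +ₛ u · ⟦ xs ⟧ →
                ⟦ [ i ×ᵍ x ] ⟧ +ₛ j · ⟦ xs ⟧ ⊆ ⟦ ys ⟧ +ₛ h · ⟦ x ∷ xs ⟧
  cover-below {t = t} i refl refl cov z∈ =
    +ₛ-monoʳ (·-∷-merge i) (+ₛ-left-comm (+ₛ-monoʳ (cover-extend t cov) z∈))

  cover-above : ∀ {x xs ys N h i j} s → s ≤ i → (i ∸ s) + j ≡ N →
                N · ⟦ x ∷ xs ⟧ ⊆ ⟦ ys ⟧ +ₛ h · ⟦ x ∷ xs ⟧ →
                ⟦ [ i ×ᵍ x ] ⟧ +ₛ j · ⟦ xs ⟧ ⊆ ⟦ sums [ s ×ᵍ x ] ys ⟧ +ₛ h · ⟦ x ∷ xs ⟧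
  cover-above {i = i} s s≤i refl cov z∈ =
    +ₛ-monoˡ ⟦⟧-+ₛ-sums
      (+ₛ-assoc⁻ (+ₛ-monoʳ (cov ∘ ·-∷-merge (i ∸ s))
        (+ₛ-assoc (+ₛ-monoˡ (×ᵍ-split s≤i) z∈))))

  MultipleCover : A → List A → ℕ → Set (c ⊔ ℓ)
  MultipleCover x xs a = ∀ h D → length xs * D ≤ a * h →
    Covered ((h + D) · ⟦ x ∷ xs ⟧) ((length xs + a) C length xs) (h · ⟦ x ∷ xs ⟧)

  multiple-cover-step : ∀ {x y xs a} → MultipleCover y xs (suc a) → MultipleCover x (y ∷ xs) a →
                        MultipleCover x (y ∷ xs) (suc a)
  multiple-cover-step {x} {y} {xs} {a} cover-tail cover-pred h D H
    with split-threshold (length xs) a D h H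
  ... | p , p≤h , tail-condition , pred-condition
    with cover-tail (h ∸ p) D tail-condition
       | cover-pred h (D ∸ (suc p ⊓ D))
           (subst (λ n → suc (length xs) * n ≤ a * h) (sym (m∸[n⊓m]≡m∸n D (suc p))) pred-condition)
  ... | ys₁ , len₁ , cov₁ | ys₂ , len₂ , cov₂ = ys₁ ++ sums [ s ×ᵍ x ] ys₂ , length-bound , covers
    where
    -- Capping at D keeps (i ∸ s) + j ≡ h + (D ∸ s) exact despite truncated subtraction.
    s : ℕ
    s = suc p ⊓ D

    length-bound : length (ys₁ ++ sums [ s ×ᵍ x ] ys₂) ≤ (suc (length xs) + suc a) C suc (length xs)
    length-bound = subst (_≤ _) (sym length-eq) (pascal-≤ (length xs) a len₁ len₂)
      where
      length-eq : length (ys₁ ++ sums [ s ×ᵍ x ] ys₂) ≡ length ys₁ + length ys₂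
      length-eq = trans (length-++ ys₁)
        (cong (length ys₁ +_) (trans (length-sums [ s ×ᵍ x ] ys₂) (*-identityˡ (length ys₂))))

    covers : (h + D) · ⟦ x ∷ y ∷ xs ⟧ ⊆ ⟦ ys₁ ++ sums [ s ×ᵍ x ] ys₂ ⟧ +ₛ h · ⟦ x ∷ y ∷ xs ⟧
    covers z∈ with ·-∷-decompose (h + D) z∈
    ... | i , j , i+j≡ , z∈′ with i ≤? p
    ... | yes i≤p = +ₛ-monoˡ ⟦⟧-++⁺ˡ
          (cover-below {u = h ∸ p} i (∸-telescope i≤p p≤h) (below-threshold-index i≤p p≤h i+j≡) cov₁ z∈′)
    ... | no  i≰p = +ₛ-monoˡ (⟦⟧-++⁺ʳ ys₁)
          (cover-above {h = h} s s≤i (above-threshold-index s≤i (m⊓n≤n (suc p) D) i+j≡) cov₂ z∈′)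
      where
      s≤i : s ≤ i
      s≤i = ≤-trans (m⊓n≤m (suc p) D) (≰⇒> i≰p)

  multiple-cover : ∀ x xs a → MultipleCover x xs a
  multiple-cover x [] a h D _ =
    [ D ×ᵍ x ] , ≤-refl , λ z∈ → +ₛ-comm (+ₛ-monoʳ (·-⟦[]⟧ D) (·-+-split h D z∈))
  multiple-cover x (y ∷ xs) zero h D H with n≤0⇒n≡0 (≤-trans (m≤m+n D (length xs * D)) H)
  ... | refl = covered-≤ 1≤[m+0]Cm (⊆⇒covered [h+0]·⊆h·)
    where
    m : ℕ
    m = suc (length xs)
    1≤[m+0]Cm : 1 ≤ (m + 0) C m
    1≤[m+0]Cm = subst (λ n → 1 ≤ n C m) (sym (+-identityʳ m)) (≤-reflexive (sym (nCn≡1 m)))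
    [h+0]·⊆h· : (h + 0) · ⟦ x ∷ y ∷ xs ⟧ ⊆ h · ⟦ x ∷ y ∷ xs ⟧
    [h+0]·⊆h· = subst (λ n → n · ⟦ x ∷ y ∷ xs ⟧ ⊆ h · ⟦ x ∷ y ∷ xs ⟧) (sym (+-identityʳ h))
                      (λ z∈ → z∈)
  multiple-cover x (y ∷ xs) (suc a) =
    multiple-cover-step (multiple-cover y xs (suc a)) (multiple-cover x (y ∷ xs) a)

  module _ {M : Subset G} (M-submonoid : IsSubmonoid G M) where
    open IsSubmonoid M-submonoid

    ·-⊆-submonoid : ∀ n → n · M ⊆ M
    ·-⊆-submonoid zero    (lift z≈ε) = resp (≈-sym z≈ε) has-ε
    ·-⊆-submonoid (suc n) (x , y , x∈ , y∈ , lift z≈xy) =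
      resp (≈-sym z≈xy) (closed x∈ (·-⊆-submonoid n y∈))

    ε∈·submonoid : ∀ n → (n · M) ε
    ε∈·submonoid zero    = lift ≈-refl
    ε∈·submonoid (suc n) = ε , ε , has-ε , ε∈·submonoid n , lift (≈-sym (identityˡ ε))

    *-·-⊆-submonoid : ∀ r h → (r * h) · M ⊆ h · M
    *-·-⊆-submonoid r zero    = subst (λ n → n · M ⊆ zeroSet G) (sym (*-zeroʳ r)) (λ z∈ → z∈)
    *-·-⊆-submonoid r (suc h) {z} z∈ =
      z , ε , ·-⊆-submonoid (r * suc h) z∈ , ε∈·submonoid h , lift (≈-sym (identityʳ z))

    sumset-cover : ∀ xs → length xs ≥ 1 → ∀ r h →
      Covered ((suc r * h) · (⟦ xs ⟧ +ₛ M))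
              ((suc (suc r) * (length xs ∸ 1)) C (length xs ∸ 1))
              (h · (⟦ xs ⟧ +ₛ M))
    sumset-cover (x ∷ xs) _ r h =
      covered-mono (·-distrib-+ₛ (suc r * h)) (·-merge-+ₛ h)
        (covered-+ₛ-⊆
          (multiple-cover x xs (suc r * length xs) h (r * h) (m*[r*h]≤[1+r]*m*h (length xs) r h))
          (*-·-⊆-submonoid (suc r) h))

theorem1p14 : ∀ {c ℓ : Level} (G : AbelianGroup c ℓ) (q : ℕ)
  (F : Fin q → List (AbelianGroup.Carrier G))
  (M : Fin q → Subset G)
  → (∀ i → Unique (AbelianGroup.setoid G) (F i))
  → (∀ i → length (F i) ≥ 1)
  → (∀ i → IsSubmonoid G (M i))
  → (r : ℕ) → r ≥ 1 → (h : Fin q → ℕ)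
  → ∃[ X ] (length X ≤ ∏ (λ i → (suc r * (length (F i) ∸ 1)) C (length (F i) ∸ 1))
      × (_·ᶜ_ G (λ i → r * h i) (λ i → _⊕_ G (listSet G (F i)) (M i))
         ⊆ _⊕_ G (listSet G X) (_·ᶜ_ G h (λ i → _⊕_ G (listSet G (F i)) (M i)))))
theorem1p14 G q F M _ nonempty submonoid (suc r) _ h =
  covered-·ᶜ G (λ i → suc r * h i) h (λ i → _⊕_ G (listSet G (F i)) (M i)) _
    (λ i → sumset-cover G (submonoid i) (F i) (nonempty i) r (h i))
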